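{- Let $m$ be a positive integer, let $x,\bar x$ be positive integers and $r,\bar r\in\{0,\dots,m-1\}$. Suppose there is a positive integer $j$ such that $r_n(x,r)=r_n(\bar x,\bar r)$ for all $n\ge j$. Then $r_n(x,r)=r_n(\bar x,\bar r)$ for all $n\ge 0$.
   Context: The triangle $T_m$ (rotation number $m$) is the array whose row $x$ ($x=1,2,\dots$) has $x$ entries in columns $0,\dots,x-1$, defined by: $T_m(1,0)=1$; for $x>1$ and $0\le c\le x-2$, $T_m(x,c)=T_m(x-1,c+m)$; and $T_m(x,x-1)=1+T_m(x-1,0)$, where for any integer $c$, $T_m(x,c)$ denotes the entry in row $x$ and column ($c$ mod $x$). Entries are regarded as individuals that move: the individual in column $c$ of row $y$ is the individual in column $(c-m)\bmod y$ of row $y+1$. An individual is said to be at position $(y,c)$ for any integer $c$ congruent modulo $y$ to its actual column in row $y$. For a positive integer $x$ and $r\in\{0,\dots,m-1\}$, consider the individual at position $(x,r)$. Set $x_0(x,r)=x$, $r_0(x,r)=r$, and for $n\ge1$ let $(x_n(x,r),r_n(x,r))$ be the lexicographically smallest pair of integers with $x_n\ge x_{n-1}$, $0\le r_n\le m-1$, $r_n>r_{n-1}$ if $x_n=x_{n-1}$, and such that this individual is at position $(x_n,r_n)$. -}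

module Defs where

open import Data.Nat using (ℕ; zero; suc; _+_; _∸_; _≤_; _<_)
open import Data.Nat.DivMod using (_%_)
open import Data.Integer as ℤ using (ℤ; +_; _-_; _%ℕ_)
open import Data.Product using (Σ; _×_)
open import Data.Sum using (_⊎_)
open import Data.Empty using (⊥)
open import Relation.Binary.PropositionalEquality using (_≡_)

-- Tracking one individual of the triangle T_m.
-- col m x r k = the actual column, in row x + k, of the individual that is
-- at position (x , r) (i.e. in column r mod x of row x).  Rule used: the
-- individual in column c of row y is in column (c - m) mod y of row y+1.
-- (x is assumed positive; the value for x = 0 is junk and never used.)
col : (m x r : ℕ) → ℕ → ℕ
col m zero    r _       = 0
col m (suc a) r zero    = r % suc a
col m (suc a) r (suc k) = ((+ col m (suc a) r k) - (+ m)) %ℕ suc (a + k)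

-- At m x r y s : the individual at position (x , r) is at position (y , s),
-- i.e. y ≥ x and s is congruent mod y to its actual column in row y.
At : (m x r y s : ℕ) → Set
At m x r zero    s = ⊥
At m x r (suc y) s = (x ≤ suc y) × (col m x r (suc y ∸ x) ≡ s % suc y)

-- Admissible candidates for (x_n , r_n) given (x_{n-1} , r_{n-1}) = (y , s).
Cand : (m x r y s y' s' : ℕ) → Set
Cand m x r y s y' s' =
  (y ≤ y') × (s' < m) × (y' ≡ y → s < s') × At m x r y' s'

LexLe : (y s y' s' : ℕ) → Set
LexLe y s y' s' = (y < y') ⊎ ((y ≡ y') × (s ≤ s'))

IsNext : (m x r y s y' s' : ℕ) → Set
IsNext m x r y s y' s' =
  Cand m x r y s y' s' ×
  ((y'' s'' : ℕ) → Cand m x r y s y'' s'' → LexLe y' s' y'' s'')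

IsSeq : (m x r : ℕ) → (xs rs : ℕ → ℕ) → Set
IsSeq m x r xs rs =
  (xs 0 ≡ x) × (rs 0 ≡ r) ×
  ((n : ℕ) → IsNext m x r (xs n) (rs n) (xs (suc n)) (rs (suc n)))

{-# OPTIONS --safe #-}
-- The column map c ↦ (c − m) mod y from row y to row y + 1 is injective on [0, y), so two
-- individuals that share a position in some row share their positions in every earlier row.
-- Together with the minimality built into (x_n , r_n), agreement of the pairs at step n + 1
-- therefore propagates back to step n.  It remains to get the pairs to agree at one step.
-- Since m x_n + r_n increases strictly, eventually x_n ≥ m; from then on the individual's
-- column drops by m per row until it falls below m, so
-- (x_{n+1} , r_{n+1}) = (x_n + (r_n + x_n) div m , (r_n + x_n) mod m) and
-- m x_{n+1} + r_{n+1} = (m + 1) x_n + r_n.  If the r's agree from some step on, the gap D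
-- between the x's satisfies m D_{n+1} = (m + 1) D_n, which for m ≥ 2 forces D = 0.
module Submission where

open import Defs
open import Data.Nat using (ℕ; zero; suc; _+_; _*_; _∸_; _⊔_; _≤_; _<_; _≤′_; ≤′-refl; ≤′-step; z≤n; s≤s; NonZero)
open import Data.Nat.Properties
open import Data.Nat.DivMod using (_%_; _/_; m%n<n; m<n⇒m%n≡m; m≡m%n+[m/n]*n; m/n*n≤m; m≥n⇒m/n>0; m*[n/m]≡n; m/n<m)
open import Data.Nat.Divisibility using (_∣_; ∣m+n∣m⇒∣n; m∣m*n)
open import Data.Nat.Induction using (<-rec)
import Data.Nat.Tactic.RingSolver as ℕ-Solver
open import Data.Integer as ℤ using (ℤ; +_; _⊖_; _%ℕ_; _/ℕ_)
import Data.Integer.Properties as ℤ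
open import Data.Integer.DivMod using (n%ℕd<d; a≡a%ℕn+[a/ℕn]*n)
open import Data.Integer.Tactic.RingSolver using (solve-∀)
open import Data.Product using (Σ; _×_; _,_; proj₁; proj₂)
open import Data.Sum using (_⊎_; inj₁; inj₂)
open import Data.Empty using (⊥-elim)
open import Relation.Binary.PropositionalEquality
  using (_≡_; refl; sym; trans; cong; cong₂; subst; subst₂; module ≡-Reasoning)
open import Relation.Binary.Definitions using (tri<; tri≈; tri>)
open import Relation.Nullary using (¬_; yes; no)

private
  [i+j]-i≡j : ∀ (i j : ℤ) → (i ℤ.+ j) ℤ.- i ≡ j
  [i+j]-i≡j = solve-∀

  [i+j]-j≡i : ∀ (i j : ℤ) → (i ℤ.+ j) ℤ.- j ≡ i
  [i+j]-j≡i = solve-∀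

  [c+k*R]-q*R : ∀ (c k q R : ℤ) → (c ℤ.+ k ℤ.* R) ℤ.- q ℤ.* R ≡ c ℤ.+ (k ℤ.- q) ℤ.* R
  [c+k*R]-q*R = solve-∀

  c-m≡[c+k*R-m]-k*R : ∀ (c k m R : ℤ) → c ℤ.- m ≡ ((c ℤ.+ k ℤ.* R) ℤ.- m) ℤ.+ (ℤ.- k) ℤ.* R
  c-m≡[c+k*R-m]-k*R = solve-∀

  a≡b+[[a-m]-[b-m]] : ∀ (a b m : ℤ) → a ≡ b ℤ.+ ((a ℤ.- m) ℤ.- (b ℤ.- m))
  a≡b+[[a-m]-[b-m]] = solve-∀

  [s+p*R]-[s+q*R] : ∀ (s p q R : ℤ) → (s ℤ.+ p ℤ.* R) ℤ.- (s ℤ.+ q ℤ.* R) ≡ (p ℤ.- q) ℤ.* R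
  [s+p*R]-[s+q*R] = solve-∀

residue-unique : ∀ {R a b} (k : ℤ) → a < R → b < R → + a ≡ + b ℤ.+ k ℤ.* + R → a ≡ b
residue-unique {R} {a} {b} k a<R b<R eq = ℤ.+-injective (let open ≡-Reasoning in begin
  + a                ≡⟨ eq ⟩
  + b ℤ.+ k ℤ.* + R  ≡⟨ cong (λ z → + b ℤ.+ z ℤ.* + R) (ℤ.∣i∣≡0⇒i≡0 {k} ∣k∣≡0) ⟩
  + b ℤ.+ + 0        ≡⟨ ℤ.+-identityʳ (+ b) ⟩
  + b                ∎)
  where
  k*R≡a⊖b : k ℤ.* + R ≡ a ⊖ b
  k*R≡a⊖b = begin
    k ℤ.* + R                    ≡⟨ [i+j]-i≡j (+ b) (k ℤ.* + R) ⟨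
    (+ b ℤ.+ k ℤ.* + R) ℤ.- + b  ≡⟨ cong (ℤ._- + b) eq ⟨
    + a ℤ.- + b                  ≡⟨ ℤ.m-n≡m⊖n a b ⟩
    a ⊖ b                        ∎
    where open ≡-Reasoning
  ∣k∣*R<R : ℤ.∣ k ∣ * R < R
  ∣k∣*R<R = begin-strict
    ℤ.∣ k ∣ * R      ≡⟨ ℤ.abs-* k (+ R) ⟨
    ℤ.∣ k ℤ.* + R ∣  ≡⟨ cong ℤ.∣_∣ k*R≡a⊖b ⟩
    ℤ.∣ a ⊖ b ∣      ≤⟨ ℤ.∣m⊝n∣≤m⊔n a b ⟩
    a ⊔ b            <⟨ ⊔-lub a<R b<R ⟩
    R                ∎
    where open ≤-Reasoning
  ∣k∣≡0 : ℤ.∣ k ∣ ≡ 0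
  ∣k∣≡0 with ℤ.∣ k ∣ | ∣k∣*R<R
  ... | zero  | _  = refl
  ... | suc n | lt = ⊥-elim (<⇒≱ lt (m≤m+n R (n * R)))

%ℕ-unique : ∀ {R} .{{_ : NonZero R}} i {c} (k : ℤ) → c < R → i ≡ + c ℤ.+ k ℤ.* + R → i %ℕ R ≡ c
%ℕ-unique {R} i {c} k c<R eq = residue-unique (k ℤ.- q) (n%ℕd<d i R) c<R (begin
  + (i %ℕ R)                                ≡⟨ [i+j]-j≡i (+ (i %ℕ R)) (q ℤ.* + R) ⟨
  (+ (i %ℕ R) ℤ.+ q ℤ.* + R) ℤ.- q ℤ.* + R  ≡⟨ cong (ℤ._- q ℤ.* + R) (a≡a%ℕn+[a/ℕn]*n i R) ⟨
  i ℤ.- q ℤ.* + R                           ≡⟨ cong (ℤ._- q ℤ.* + R) eq ⟩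
  (+ c ℤ.+ k ℤ.* + R) ℤ.- q ℤ.* + R         ≡⟨ [c+k*R]-q*R (+ c) k q (+ R) ⟩
  + c ℤ.+ (k ℤ.- q) ℤ.* + R                 ∎)
  where
  open ≡-Reasoning
  q : ℤ
  q = i /ℕ R

shift-mod : ∀ {R} .{{_ : NonZero R}} {m c c'} k → c' < R → c + k * R ≡ c' + m → (+ c ℤ.- + m) %ℕ R ≡ c'
shift-mod {R} {m} {c} {c'} k c'<R eq = %ℕ-unique (+ c ℤ.- + m) (ℤ.- + k) c'<R (begin
  + c ℤ.- + m                                         ≡⟨ c-m≡[c+k*R-m]-k*R (+ c) (+ k) (+ m) (+ R) ⟩
  ((+ c ℤ.+ + k ℤ.* + R) ℤ.- + m) ℤ.+ ℤ.- + k ℤ.* + R  ≡⟨ cong (λ z → (z ℤ.- + m) ℤ.+ ℤ.- + k ℤ.* + R) eqℤ ⟩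
  ((+ c' ℤ.+ + m) ℤ.- + m) ℤ.+ ℤ.- + k ℤ.* + R         ≡⟨ cong (ℤ._+ ℤ.- + k ℤ.* + R) ([i+j]-j≡i (+ c') (+ m)) ⟩
  + c' ℤ.+ ℤ.- + k ℤ.* + R                             ∎)
  where
  open ≡-Reasoning
  eqℤ : + c ℤ.+ + k ℤ.* + R ≡ + c' ℤ.+ + m
  eqℤ = begin
    + c ℤ.+ + k ℤ.* + R  ≡⟨ cong (λ z → + c ℤ.+ z) (ℤ.pos-* k R) ⟨
    + c ℤ.+ + (k * R)    ≡⟨ ℤ.pos-+ c (k * R) ⟨
    + (c + k * R)        ≡⟨ cong +_ eq ⟩
    + (c' + m)           ≡⟨ ℤ.pos-+ c' m ⟩
    + c' ℤ.+ + m         ∎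

shift-injective : ∀ {R} .{{_ : NonZero R}} {m a b} → a < R → b < R →
  (+ a ℤ.- + m) %ℕ R ≡ (+ b ℤ.- + m) %ℕ R → a ≡ b
shift-injective {R} {m} {a} {b} a<R b<R eq = residue-unique (p ℤ.- q) a<R b<R (begin
  + a                                                   ≡⟨ a≡b+[[a-m]-[b-m]] (+ a) (+ b) (+ m) ⟩
  + b ℤ.+ (i ℤ.- j)                                     ≡⟨ cong₂ (λ u v → + b ℤ.+ (u ℤ.- v)) i≡ (a≡a%ℕn+[a/ℕn]*n j R) ⟩
  + b ℤ.+ ((+ s ℤ.+ p ℤ.* + R) ℤ.- (+ s ℤ.+ q ℤ.* + R))  ≡⟨ cong (λ z → + b ℤ.+ z) ([s+p*R]-[s+q*R] (+ s) p q (+ R)) ⟩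
  + b ℤ.+ (p ℤ.- q) ℤ.* + R                             ∎)
  where
  open ≡-Reasoning
  i j p q : ℤ
  i = + a ℤ.- + m
  j = + b ℤ.- + m
  p = i /ℕ R
  q = j /ℕ R
  s : ℕ
  s = j %ℕ R
  i≡ : i ≡ + s ℤ.+ p ℤ.* + R
  i≡ = trans (a≡a%ℕn+[a/ℕn]*n i R) (cong (λ z → + z ℤ.+ p ℤ.* + R) eq)

column : (m x r y : ℕ) → ℕ
column m x r y = col m x r (y ∸ x)

column-step : ∀ m a r {y} .{{_ : NonZero y}} → suc a ≤ y →
  column m (suc a) r (suc y) ≡ (+ column m (suc a) r y ℤ.- + m) %ℕ y
column-step m a r {suc y} (s≤s a≤y) rewrite +-∸-assoc 1 a≤y | m+[n∸m]≡n a≤y = refl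

col<row : ∀ m a r k → col m (suc a) r k < suc (a + k)
col<row m a r zero    rewrite +-identityʳ a = m%n<n r (suc a)
col<row m a r (suc k) = <-≤-trans (n%ℕd<d (+ col m (suc a) r k ℤ.- + m) (suc (a + k))) (s≤s (+-monoʳ-≤ a (n≤1+n k)))

column<row : ∀ m a r {y} → suc a ≤ y → column m (suc a) r y < y
column<row m a r {y} a<y = subst (column m (suc a) r y <_) (m+[n∸m]≡n a<y) (col<row m a r (y ∸ suc a))

column-agree-pred : ∀ {m a b r r̄ y} → suc a ≤ y → suc b ≤ y →
  column m (suc a) r (suc y) ≡ column m (suc b) r̄ (suc y) → column m (suc a) r y ≡ column m (suc b) r̄ y
column-agree-pred {m} {a} {b} {r} {r̄} {suc y} a<y b<y eq =
  shift-injective {m = m} (column<row m a r a<y) (column<row m b r̄ b<y)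
    (trans (sym (column-step m a r a<y)) (trans eq (column-step m b r̄ b<y)))

column-agree-downward : ∀ {m a b r r̄ Y Z} → suc a ≤ Y → suc b ≤ Y → Y ≤′ Z →
  column m (suc a) r Z ≡ column m (suc b) r̄ Z → column m (suc a) r Y ≡ column m (suc b) r̄ Y
column-agree-downward a<Y b<Y ≤′-refl         eq = eq
column-agree-downward a<Y b<Y (≤′-step Y≤′Z) eq =
  column-agree-downward a<Y b<Y Y≤′Z
    (column-agree-pred (≤-trans a<Y (≤′⇒≤ Y≤′Z)) (≤-trans b<Y (≤′⇒≤ Y≤′Z)) eq)

At-self : ∀ m {x} r → 1 ≤ x → At m x r x r
At-self m {suc a} r _ rewrite n∸n≡0 a = ≤-refl , refl

At⇒column≡ : ∀ {m x r y s} → s < y → At m x r y s → column m x r y ≡ s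
At⇒column≡ {y = suc y} s<y (_ , eq) = trans eq (m<n⇒m%n≡m s<y)

column≡⇒At : ∀ {m x r y s} → x ≤ y → s < y → column m x r y ≡ s → At m x r y s
column≡⇒At {y = suc y} x≤y s<y eq = x≤y , trans eq (sym (m<n⇒m%n≡m s<y))

At-shared-downward : ∀ {m x x̄ r r̄ Y Z S T} → 1 ≤ x → 1 ≤ x̄ → x ≤ Y → Y ≤ Z →
  At m x̄ r̄ Y S → At m x r Z T → At m x̄ r̄ Z T → At m x r Y S
At-shared-downward {x = suc a} {suc b} {Y = suc Y} {suc Z} _ _ x≤Y Y≤Z (x̄≤Y , eq̄Y) (_ , eqZ) (_ , eq̄Z) =
  x≤Y , trans (column-agree-downward x≤Y x̄≤Y (≤⇒≤′ Y≤Z) (trans eqZ (sym eq̄Z))) eq̄Y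

LexLt : (y s y' s' : ℕ) → Set
LexLt y s y' s' = (y < y') ⊎ ((y ≡ y') × (s < s'))

LexLe⇒≯ : ∀ {a b c d} → LexLe a b c d → ¬ LexLt c d a b
LexLe⇒≯ (inj₁ a<c)          (inj₁ c<a)        = <-asym a<c c<a
LexLe⇒≯ (inj₁ a<c)          (inj₂ (refl , _)) = <-irrefl refl a<c
LexLe⇒≯ (inj₂ (refl , _))   (inj₁ c<a)        = <-irrefl refl c<a
LexLe⇒≯ (inj₂ (refl , b≤d)) (inj₂ (_ , d<b))  = <⇒≱ d<b b≤d

LexLe-antisym : ∀ {a b c d} → LexLe a b c d → LexLe c d a b → (a ≡ c) × (b ≡ d)
LexLe-antisym (inj₁ a<c)          (inj₁ c<a)          = ⊥-elim (<-asym a<c c<a)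
LexLe-antisym (inj₁ a<c)          (inj₂ (refl , _))   = ⊥-elim (<-irrefl refl a<c)
LexLe-antisym (inj₂ (refl , _))   (inj₁ c<a)          = ⊥-elim (<-irrefl refl c<a)
LexLe-antisym (inj₂ (refl , b≤d)) (inj₂ (_ , d≤b))    = refl , ≤-antisym b≤d d≤b

LexLt-trichotomy : ∀ a b c d → LexLt a b c d ⊎ ((a ≡ c) × (b ≡ d)) ⊎ LexLt c d a b
LexLt-trichotomy a b c d with <-cmp a c
... | tri< a<c _ _ = inj₁ (inj₁ a<c)
... | tri> _ _ c<a = inj₂ (inj₂ (inj₁ c<a))
... | tri≈ _ refl _ with <-cmp b d
...   | tri< b<d _ _ = inj₁ (inj₂ (refl , b<d))
...   | tri≈ _ b≡d _ = inj₂ (inj₁ (refl , b≡d))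
...   | tri> _ _ d<b = inj₂ (inj₂ (inj₂ (refl , d<b)))

LexLt⇒≤ : ∀ {a b c d} → LexLt a b c d → a ≤ c
LexLt⇒≤ (inj₁ a<c)        = <⇒≤ a<c
LexLt⇒≤ (inj₂ (refl , _)) = ≤-refl

LexLt⇒same-row⇒< : ∀ {a b c d} → LexLt a b c d → c ≡ a → b < d
LexLt⇒same-row⇒< (inj₁ a<c)       refl = ⊥-elim (<-irrefl refl a<c)
LexLt⇒same-row⇒< (inj₂ (_ , b<d)) _    = b<d

Cand⇒LexLt : ∀ {m x r y s y' s'} → Cand m x r y s y' s' → LexLt y s y' s'
Cand⇒LexLt (y≤y' , _ , same-row⇒s<s' , _) with m≤n⇒m<n∨m≡n y≤y'
... | inj₁ y<y' = inj₁ y<y'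
... | inj₂ y≡y' = inj₂ (y≡y' , same-row⇒s<s' (sym y≡y'))

module Sequence {m x r : ℕ} {xs rs : ℕ → ℕ} (seq : IsSeq m x r xs rs) where

  next : ∀ n → IsNext m x r (xs n) (rs n) (xs (suc n)) (rs (suc n))
  next = proj₂ (proj₂ seq)

  cand : ∀ n → Cand m x r (xs n) (rs n) (xs (suc n)) (rs (suc n))
  cand n = proj₁ (next n)

  xs-step : ∀ n → xs n ≤ xs (suc n)
  xs-step n = proj₁ (cand n)

  x≤xs : ∀ n → x ≤ xs n
  x≤xs zero    = ≤-reflexive (sym (proj₁ seq))
  x≤xs (suc n) = ≤-trans (x≤xs n) (xs-step n)

  rs<m : r < m → ∀ n → rs n < m
  rs<m r<m zero    = subst (_< m) (sym (proj₁ (proj₂ seq))) r<m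
  rs<m r<m (suc n) = proj₁ (proj₂ (cand n))

  position : 1 ≤ x → ∀ n → At m x r (xs n) (rs n)
  position 1≤x zero    = subst₂ (At m x r) (sym (proj₁ seq)) (sym (proj₁ (proj₂ seq))) (At-self m r 1≤x)
  position 1≤x (suc n) = proj₂ (proj₂ (proj₂ (cand n)))

  potential : ℕ → ℕ
  potential n = m * xs n + rs n

  potential-<-m*[1+xs] : r < m → ∀ n → potential n < m * suc (xs n)
  potential-<-m*[1+xs] r<m n = subst (potential n <_) (trans (+-comm (m * xs n) m) (sym (*-suc m (xs n))))
    (+-monoʳ-< (m * xs n) (rs<m r<m n))

  potential-increasing : r < m → ∀ n → potential n < potential (suc n)
  potential-increasing r<m n with Cand⇒LexLt (cand n)
  ... | inj₁ xs<xs' = <-≤-trans (potential-<-m*[1+xs] r<m n) (≤-trans (*-monoʳ-≤ m xs<xs') (m≤m+n _ _))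
  ... | inj₂ (xs≡xs' , rs<rs') rewrite xs≡xs' = +-monoʳ-< (m * xs (suc n)) rs<rs'

  n≤potential : r < m → ∀ n → n ≤ potential n
  n≤potential r<m zero    = z≤n
  n≤potential r<m (suc n) = <-≤-trans (s≤s (n≤potential r<m n)) (potential-increasing r<m n)

  m≤xs : r < m → ∀ n → m * m ≤ n → m ≤ xs n
  m≤xs r<m n m*m≤n with m ≤? xs n
  ... | yes m≤xsₙ = m≤xsₙ
  ... | no  m≰xs  = ⊥-elim (<⇒≱ n<m*m m*m≤n)
    where
    n<m*m : n < m * m
    n<m*m = ≤-<-trans (n≤potential r<m n)
              (<-≤-trans (potential-<-m*[1+xs] r<m n) (*-monoʳ-≤ m (≰⇒> m≰xs)))

-- If the first sequence were lexicographically behind at step n, the second one's position at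
-- step n would be a candidate for the first one's step n + 1 (the two individuals coincide
-- at step n + 1), and a smaller one than the chosen (x_{n+1} , r_{n+1}).
next-agree⇒¬LexLt : ∀ {m x x̄ r r̄ xs rs x̄s r̄s} → 1 ≤ x → 1 ≤ x̄ → r̄ < m →
  IsSeq m x r xs rs → IsSeq m x̄ r̄ x̄s r̄s → ∀ n →
  xs (suc n) ≡ x̄s (suc n) → rs (suc n) ≡ r̄s (suc n) → ¬ LexLt (xs n) (rs n) (x̄s n) (r̄s n)
next-agree⇒¬LexLt {m} {x} {x̄} {r} {r̄} {xs} {rs} {x̄s} {r̄s} 1≤x 1≤x̄ r̄<m seq seq̄ n x-eq r-eq behind =
  LexLe⇒≯ (proj₂ (A.next n) (x̄s n) (r̄s n) candidate)
    (subst₂ (LexLt (x̄s n) (r̄s n)) (sym x-eq) (sym r-eq) (Cand⇒LexLt (B.cand n)))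
  where
  module A = Sequence seq
  module B = Sequence seq̄
  shared : At m x̄ r̄ (xs (suc n)) (rs (suc n))
  shared = subst₂ (At m x̄ r̄) (sym x-eq) (sym r-eq) (B.position 1≤x̄ (suc n))
  xs≤x̄s : xs n ≤ x̄s n
  xs≤x̄s = LexLt⇒≤ behind
  candidate : Cand m x r (xs n) (rs n) (x̄s n) (r̄s n)
  candidate = xs≤x̄s , B.rs<m r̄<m n , LexLt⇒same-row⇒< behind ,
    At-shared-downward 1≤x 1≤x̄ (≤-trans (A.x≤xs n) xs≤x̄s) (subst (x̄s n ≤_) (sym x-eq) (B.xs-step n))
      (B.position 1≤x̄ n) (A.position 1≤x (suc n)) shared

next-agree⇒agree : ∀ {m x x̄ r r̄ xs rs x̄s r̄s} → 1 ≤ x → 1 ≤ x̄ → r < m → r̄ < m →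
  IsSeq m x r xs rs → IsSeq m x̄ r̄ x̄s r̄s → ∀ n →
  (xs (suc n) ≡ x̄s (suc n)) × (rs (suc n) ≡ r̄s (suc n)) → (xs n ≡ x̄s n) × (rs n ≡ r̄s n)
next-agree⇒agree {xs = xs} {rs} {x̄s} {r̄s} 1≤x 1≤x̄ r<m r̄<m seq seq̄ n (x-eq , r-eq)
  with LexLt-trichotomy (xs n) (rs n) (x̄s n) (r̄s n)
... | inj₁ behind         = ⊥-elim (next-agree⇒¬LexLt 1≤x 1≤x̄ r̄<m seq seq̄ n x-eq r-eq behind)
... | inj₂ (inj₁ equal)   = equal
... | inj₂ (inj₂ ahead)   = ⊥-elim (next-agree⇒¬LexLt 1≤x̄ 1≤x r<m seq̄ seq n (sym x-eq) (sym r-eq) ahead)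

-- Entered at column s < m of a row y ≥ m, the individual wraps around to column s + y − m in
-- the next row and then loses m per row.  Rows are indexed as i + y so that suc i + y reduces
-- to suc (i + y).
module RegularStep {m' a r y₀ s : ℕ} (m≤y : suc m' ≤ suc y₀) (s<m : s < suc m')
                   (at : At (suc m') (suc a) r (suc y₀) s) where
  m y u t : ℕ
  m = suc m'
  y = suc y₀
  u = s + y
  t = u / m

  x≤y : suc a ≤ y
  x≤y = proj₁ at

  below-m⇒below-row : ∀ i {c} → c < m → c < i + y
  below-m⇒below-row i c<m = <-≤-trans c<m (≤-trans m≤y (m≤n+m y i))

  column-y : column m (suc a) r y ≡ s
  column-y = At⇒column≡ (below-m⇒below-row 0 s<m) at

  m≤u : m ≤ u
  m≤u = ≤-trans m≤y (m≤n+m y s)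

  u∸m<y : u ∸ m < y
  u∸m<y = subst (u ∸ m <_) (m+n∸m≡n m y) (∸-monoˡ-< (+-monoˡ-< y s<m) m≤u)

  m≤column : ∀ {c k} → c + k * m ≡ u → suc k ≤ t → m ≤ c
  m≤column {c} {k} c+k*m≡u 1+k≤t = +-cancelʳ-≤ (k * m) m c (begin
    m + k * m  ≤⟨ *-monoˡ-≤ m 1+k≤t ⟩
    t * m      ≤⟨ m/n*n≤m u m ⟩
    u          ≡⟨ c+k*m≡u ⟨
    c + k * m  ∎)
    where open ≤-Reasoning

  descent : ∀ i → suc i ≤ t → column m (suc a) r (suc i + y) + suc i * m ≡ u
  descent zero _ = begin
    column m (suc a) r (suc y) + 1 * m  ≡⟨ cong₂ _+_ first-row (*-identityˡ m) ⟩
    (u ∸ m) + m                         ≡⟨ m∸n+n≡m m≤u ⟩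
    u                                   ∎
    where
    open ≡-Reasoning
    first-row : column m (suc a) r (suc y) ≡ u ∸ m
    first-row = trans (column-step m a r x≤y)
      (trans (cong (λ c → (+ c ℤ.- + m) %ℕ y) column-y)
        (shift-mod 1 u∸m<y (trans (cong (λ k → s + k) (*-identityˡ y)) (sym (m∸n+n≡m m≤u)))))
  descent (suc i) 2+i≤t = begin
    column m (suc a) r (suc (suc i) + y) + suc (suc i) * m  ≡⟨ cong (_+ suc (suc i) * m) next-row ⟩
    (c ∸ m) + (m + suc i * m)                              ≡⟨ +-assoc (c ∸ m) m (suc i * m) ⟨
    (c ∸ m) + m + suc i * m                                ≡⟨ cong (_+ suc i * m) (m∸n+n≡m m≤c) ⟩
    c + suc i * m                                          ≡⟨ previous ⟩
    u                                                      ∎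
    where
    open ≡-Reasoning
    c : ℕ
    c = column m (suc a) r (suc i + y)
    previous : c + suc i * m ≡ u
    previous = descent i (≤-trans (n≤1+n (suc i)) 2+i≤t)
    m≤c : m ≤ c
    m≤c = m≤column previous 2+i≤t
    c∸m<row : c ∸ m < suc i + y
    c∸m<row = ≤-<-trans (∸-monoˡ-≤ m (subst (c ≤_) previous (m≤m+n c (suc i * m))))
                (<-≤-trans u∸m<y (m≤n+m y (suc i)))
    next-row : column m (suc a) r (suc (suc i) + y) ≡ c ∸ m
    next-row = trans (column-step m a r (≤-trans x≤y (m≤n+m y (suc i))))
      (shift-mod 0 c∸m<row (trans (+-identityʳ c) (sym (m∸n+n≡m m≤c))))

  1≤t : 1 ≤ t
  1≤t = m≥n⇒m/n>0 m≤u

  column-at-t : column m (suc a) r (t + y) ≡ u % m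
  column-at-t = +-cancelʳ-≡ (t * m) _ _ (trans landing (m≡m%n+[m/n]*n u m))
    where
    landing : column m (suc a) r (t + y) + t * m ≡ u
    landing = subst (λ k → column m (suc a) r (k + y) + k * m ≡ u) (m+[n∸m]≡n 1≤t)
                (descent (t ∸ 1) (≤-reflexive (m+[n∸m]≡n 1≤t)))

  candidate-t : Cand m (suc a) r y s (t + y) (u % m)
  candidate-t = m≤n+m y t , m%n<n u m ,
    (λ t+y≡y → ⊥-elim (<-irrefl (sym t+y≡y) (m<n+m y 1≤t))) ,
    column≡⇒At (≤-trans x≤y (m≤n+m y t)) (below-m⇒below-row t (m%n<n u m)) column-at-t

  candidate-bound : ∀ i {s'} → Cand m (suc a) r y s (i + y) s' → LexLe (t + y) (u % m) (i + y) s'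
  candidate-bound zero {s'} (_ , s'<m , same-row⇒s<s' , at') = ⊥-elim (<-irrefl s≡s' (same-row⇒s<s' refl))
    where
    s≡s' : s ≡ s'
    s≡s' = trans (sym column-y) (At⇒column≡ (below-m⇒below-row 0 s'<m) at')
  candidate-bound (suc j) {s'} (_ , s'<m , _ , at') with <-cmp (suc j) t
  ... | tri< 1+j<t _ _ = ⊥-elim (<⇒≱ s'<m (subst (m ≤_) column≡s' (m≤column (descent j (<⇒≤ 1+j<t)) 1+j<t)))
    where
    column≡s' : column m (suc a) r (suc j + y) ≡ s'
    column≡s' = At⇒column≡ (below-m⇒below-row (suc j) s'<m) at'
  ... | tri≈ _ 1+j≡t _ = inj₂ (cong (_+ y) (sym 1+j≡t) , ≤-reflexive (trans (sym column-at-t) column≡s'))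
    where
    column≡s' : column m (suc a) r (t + y) ≡ s'
    column≡s' = subst (λ k → column m (suc a) r (k + y) ≡ s') 1+j≡t
                  (At⇒column≡ (below-m⇒below-row (suc j) s'<m) at')
  ... | tri> _ _ t<1+j = inj₁ (+-monoˡ-< y t<1+j)

  next-regular : ∀ {y' s'} → IsNext m (suc a) r y s y' s' → (y' ≡ t + y) × (s' ≡ u % m)
  next-regular {y'} {s'} (cand , minimal) = LexLe-antisym (minimal (t + y) (u % m) candidate-t) bound
    where
    y≤y' : y ≤ y'
    y≤y' = proj₁ cand
    bound : LexLe (t + y) (u % m) y' s'
    bound = subst (λ Y → LexLe (t + y) (u % m) Y s') (m∸n+n≡m y≤y')
              (candidate-bound (y' ∸ y) (subst (λ Y → Cand m (suc a) r y s Y s') (sym (m∸n+n≡m y≤y')) cand))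

next-in-regular-rows : ∀ {m x r y s y' s'} .{{_ : NonZero m}} → 1 ≤ x → m ≤ y → s < m → At m x r y s →
  IsNext m x r y s y' s' → (y' ≡ (s + y) / m + y) × (s' ≡ (s + y) % m)
next-in-regular-rows {suc m'} {suc a} {y = suc y₀} _ m≤y s<m at = RegularStep.next-regular m≤y s<m at

potential-after-regular-step : ∀ m {y s y' s'} .{{_ : NonZero m}} →
  (y' ≡ (s + y) / m + y) × (s' ≡ (s + y) % m) → m * y' + s' ≡ (m * y + s) + y
potential-after-regular-step m {y} {s} (refl , refl) = begin
  m * ((s + y) / m + y) + (s + y) % m      ≡⟨ rearrange m y ((s + y) / m) ((s + y) % m) ⟩
  m * y + ((s + y) % m + (s + y) / m * m)  ≡⟨ cong (λ k → m * y + k) (m≡m%n+[m/n]*n (s + y) m) ⟨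
  m * y + (s + y)                          ≡⟨ +-assoc (m * y) s y ⟨
  (m * y + s) + y                          ∎
  where
  open ≡-Reasoning
  rearrange : ∀ k z q ρ → k * (q + z) + ρ ≡ k * z + (ρ + q * k)
  rearrange = ℕ-Solver.solve-∀

regular-potential-step : ∀ {m x r xs rs} .{{_ : NonZero m}} → 1 ≤ x → r < m → (seq : IsSeq m x r xs rs) →
  ∀ n → m ≤ xs n → Sequence.potential seq (suc n) ≡ Sequence.potential seq n + xs n
regular-potential-step {m} 1≤x r<m seq n m≤xsₙ = potential-after-regular-step m
  (next-in-regular-rows 1≤x m≤xsₙ (rs<m r<m n) (position 1≤x n) (next n))
  where open Sequence seq

-- D n = (1 + 1/m)ⁿ D 0 must stay integral, so D 0 is divisible by every power of m;
-- the descent replaces D by D / m, which obeys the same recurrence.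
ratio-descent : ∀ {m} → 1 < m → (D : ℕ → ℕ) → (∀ n → m * D (suc n) ≡ suc m * D n) → D 0 ≡ 0
ratio-descent {m@(suc (suc _))} (s≤s (s≤s z≤n)) D step = <-rec P descend (D 0) D refl step
  where
  P : ℕ → Set
  P d = ∀ D → D 0 ≡ d → (∀ n → m * D (suc n) ≡ suc m * D n) → d ≡ 0
  descend : ∀ d → (∀ {d'} → d' < d → P d') → P d
  descend zero    _  _ _     _    = refl
  descend (suc d) ih D D0≡d step = begin
    suc d      ≡⟨ D0≡d ⟨
    D 0        ≡⟨ D≡m*E 0 ⟩
    m * E 0    ≡⟨ cong (m *_) (ih E0<d E refl E-step) ⟩
    m * 0      ≡⟨ *-zeroʳ m ⟩
    0          ∎
    where
    open ≡-Reasoning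
    *-left-comm : ∀ a b c → a * (b * c) ≡ b * (a * c)
    *-left-comm = ℕ-Solver.solve-∀
    m∣D : ∀ n → m ∣ D n
    m∣D n = ∣m+n∣m⇒∣n (subst (m ∣_) (trans (step n) (+-comm (D n) (m * D n))) (m∣m*n (D (suc n)))) (m∣m*n (D n))
    E : ℕ → ℕ
    E n = D n / m
    D≡m*E : ∀ n → D n ≡ m * E n
    D≡m*E n = sym (m*[n/m]≡n (m∣D n))
    E-step : ∀ n → m * E (suc n) ≡ suc m * E n
    E-step n = *-cancelˡ-≡ _ _ m (begin
      m * (m * E (suc n))   ≡⟨ cong (m *_) (D≡m*E (suc n)) ⟨
      m * D (suc n)         ≡⟨ step n ⟩
      suc m * D n           ≡⟨ cong (suc m *_) (D≡m*E n) ⟩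
      suc m * (m * E n)     ≡⟨ *-left-comm (suc m) m (E n) ⟩
      m * (suc m * E n)     ∎)
    E0<d : E 0 < suc d
    E0<d = subst (λ k → k / m < suc d) (sym D0≡d) (m/n<m (suc d) m (s≤s (s≤s z≤n)))

rows-coincide : ∀ {m} → 1 < m → (N : ℕ) (y ȳ s : ℕ → ℕ) →
  (∀ n → N ≤ n → m * y (suc n) + s (suc n) ≡ (m * y n + s n) + y n) →
  (∀ n → N ≤ n → m * ȳ (suc n) + s (suc n) ≡ (m * ȳ n + s n) + ȳ n) →
  y N ≡ ȳ N
rows-coincide {m} 1<m N y ȳ s step step̄ =
  ≤-antisym (m∸n≡0⇒m≤n (gap-vanishes ȳ y step̄ step)) (m∸n≡0⇒m≤n (gap-vanishes y ȳ step step̄))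
  where
  RegularFrom : (ℕ → ℕ) → Set
  RegularFrom z = ∀ n → N ≤ n → m * z (suc n) + s (suc n) ≡ (m * z n + s n) + z n
  regroup : ∀ k z c → k * z + c + z ≡ c + suc k * z
  regroup = ℕ-Solver.solve-∀
  gap-vanishes : ∀ y ȳ → RegularFrom y → RegularFrom ȳ → ȳ N ∸ y N ≡ 0
  gap-vanishes y ȳ step step̄ = ratio-descent 1<m (λ k → ȳ (k + N) ∸ y (k + N)) gap-step
    where
    gap-step : ∀ k → m * (ȳ (suc k + N) ∸ y (suc k + N)) ≡ suc m * (ȳ (k + N) ∸ y (k + N))
    gap-step k = begin
      m * (ȳ (suc n) ∸ y (suc n))                            ≡⟨ *-distribˡ-∸ m (ȳ (suc n)) (y (suc n)) ⟩
      m * ȳ (suc n) ∸ m * y (suc n)                          ≡⟨ [m+n]∸[m+o]≡n∸o (s (suc n)) _ _ ⟨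
      (s (suc n) + m * ȳ (suc n)) ∸ (s (suc n) + m * y (suc n))
        ≡⟨ cong₂ _∸_ (trans (+-comm (s (suc n)) _) (step̄ n N≤n)) (trans (+-comm (s (suc n)) _) (step n N≤n)) ⟩
      (m * ȳ n + s n + ȳ n) ∸ (m * y n + s n + y n)          ≡⟨ cong₂ _∸_ (regroup m (ȳ n) (s n)) (regroup m (y n) (s n)) ⟩
      (s n + suc m * ȳ n) ∸ (s n + suc m * y n)              ≡⟨ [m+n]∸[m+o]≡n∸o (s n) _ _ ⟩
      suc m * ȳ n ∸ suc m * y n                              ≡⟨ *-distribˡ-∸ (suc m) (ȳ n) (y n) ⟨
      suc m * (ȳ n ∸ y n)                                    ∎
      where
      open ≡-Reasoning
      n : ℕ
      n = k + N
      N≤n : N ≤ n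
      N≤n = m≤n+m N k

downward-induction : (P : ℕ → Set) → (∀ n → P (suc n) → P n) → ∀ {n N} → n ≤ N → P N → P n
downward-induction P step n≤N = go (≤⇒≤′ n≤N)
  where
  go : ∀ {n N} → n ≤′ N → P N → P n
  go ≤′-refl        p = p
  go (≤′-step n≤′N) p = go n≤′N (step _ p)

corollary2 : (m : ℕ) → 1 ≤ m →
    (x x̄ r r̄ : ℕ) → 1 ≤ x → 1 ≤ x̄ → r < m → r̄ < m →
    (xs rs x̄s r̄s : ℕ → ℕ) →
    IsSeq m x r xs rs → IsSeq m x̄ r̄ x̄s r̄s →
    Σ ℕ (λ j → (1 ≤ j) × ((n : ℕ) → j ≤ n → rs n ≡ r̄s n)) →
    (n : ℕ) → rs n ≡ r̄s n
corollary2 (suc zero) _ _ _ _ _ _ _ r<1 r̄<1 _ _ _ _ seq seq̄ _ n =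
  trans (n<1⇒n≡0 (Sequence.rs<m seq r<1 n)) (sym (n<1⇒n≡0 (Sequence.rs<m seq̄ r̄<1 n)))
corollary2 m@(suc (suc _)) _ _ _ _ _ 1≤x 1≤x̄ r<m r̄<m xs rs x̄s r̄s seq seq̄ (j , _ , late) n with j ≤? n
... | yes j≤n = late n j≤n
... | no  j≰n = proj₂ (downward-induction Agree (next-agree⇒agree 1≤x 1≤x̄ r<m r̄<m seq seq̄)
                  (≤-trans (<⇒≤ (≰⇒> j≰n)) j≤N) (rows-agree , late N j≤N))
  where
  N : ℕ
  N = j + m * m
  j≤N : j ≤ N
  j≤N = m≤m+n j (m * m)
  Agree : ℕ → Set
  Agree n = (xs n ≡ x̄s n) × (rs n ≡ r̄s n)
  regular : ∀ {x r xs rs} → 1 ≤ x → r < m → (seq : IsSeq m x r xs rs) → ∀ n → N ≤ n →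
    m * xs (suc n) + rs (suc n) ≡ (m * xs n + rs n) + xs n
  regular 1≤x r<m seq n N≤n = regular-potential-step 1≤x r<m seq n
    (Sequence.m≤xs seq r<m n (≤-trans (m≤n+m (m * m) j) N≤n))
  rows-agree : xs N ≡ x̄s N
  rows-agree = rows-coincide {m} (s≤s (s≤s z≤n)) N xs x̄s rs (regular 1≤x r<m seq) λ n N≤n →
    subst₂ (λ a b → m * x̄s (suc n) + a ≡ (m * x̄s n + b) + x̄s n)
      (sym (late (suc n) (≤-trans j≤N (m≤n⇒m≤1+n N≤n)))) (sym (late n (≤-trans j≤N N≤n)))
      (regular 1≤x̄ r̄<m seq̄ n N≤n)
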